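{- Let $\mathcal{C}$ be a category with binary products, $\Sigma$ an endofunctor with initial algebra $(\mu\Sigma,\iota)$ and free algebras $\Sigma^{\star}X$, $B$ an endofunctor, and $\rho$ a pre-GSOS law of $\Sigma$ over $B$ with operational model $\gamma\colon\mu\Sigma\to B(\mu\Sigma)$ and extension $\rho^{*}$. If $\rho$ is natural with respect to $\hat\iota\colon\Sigma^{\star}(\mu\Sigma)\to\mu\Sigma$, then $\gamma\circ\hat\iota=B\hat\iota\circ\rho^{*}_{\mu\Sigma}\circ\Sigma^{\star}\langle\mathrm{id},\gamma\rangle$.
   Context: Free algebras $(\Sigma^{\star}X,\iota_X)$ with universal maps $\eta_X$ form the free monad $\Sigma^{\star}$ with multiplication $\mu$. $\hat\iota$ is the unique $\Sigma$-algebra morphism $(\Sigma^{\star}(\mu\Sigma),\iota_{\mu\Sigma})\to(\mu\Sigma,\iota)$ with $\hat\iota\circ\eta_{\mu\Sigma}=\mathrm{id}$. A pre-GSOS law is a family $\rho_X\colon\Sigma(X\times BX)\to B\Sigma^{\star}X$, natural w.r.t. $g\colon X\to Y$ if $\rho_Y\circ\Sigma(g\times Bg)=B\Sigma^{\star}g\circ\rho_X$. Its operational model is the unique $\gamma$ with $\gamma\circ\iota=B\hat\iota\circ\rho_{\mu\Sigma}\circ\Sigma\langle\mathrm{id},\gamma\rangle$. Its extension $\rho^{*}_X\colon\Sigma^{\star}(X\times BX)\to B\Sigma^{\star}X$ is the unique morphism with $\rho^{*}_X\circ\eta_{X\times BX}=B\eta_X\circ\mathsf{outr}$ and $\rho^{*}_X\circ\iota_{X\times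 BX}=B\mu_X\circ\rho_{\Sigma^{\star}X}\circ\Sigma\langle\Sigma^{\star}\mathsf{outl},\rho^{*}_X\rangle$. -}

module Defs where

open import Level using (Level; _⊔_; suc)
open import Relation.Binary using (IsEquivalence)
import Data.Product as Prod

record Category (o ℓ e : Level) : Set (suc (o ⊔ ℓ ⊔ e)) where
  infixr 9 _∘_
  infix  4 _≈_
  field
    Obj   : Set o
    Hom   : Obj → Obj → Set ℓ
    _≈_   : ∀ {A B} → Hom A B → Hom A B → Set e
    id    : ∀ {A} → Hom A A
    _∘_   : ∀ {A B C} → Hom B C → Hom A B → Hom A C
    ≈-equiv : ∀ {A B} → IsEquivalence (_≈_ {A} {B})
    assoc : ∀ {A B C D} {f : Hom A B} {g : Hom B C} {h : Hom C D} →
            (h ∘ g) ∘ f ≈ h ∘ (g ∘ f)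
    identityˡ : ∀ {A B} {f : Hom A B} → id ∘ f ≈ f
    identityʳ : ∀ {A B} {f : Hom A B} → f ∘ id ≈ f
    ∘-resp-≈ : ∀ {A B C} {f h : Hom B C} {g i : Hom A B} →
               f ≈ h → g ≈ i → f ∘ g ≈ h ∘ i

record BinaryProducts {o ℓ e} (C : Category o ℓ e) : Set (o ⊔ ℓ ⊔ e) where
  open Category C
  infixr 7 _×_
  field
    _×_   : Obj → Obj → Obj
    outl  : ∀ {A B} → Hom (A × B) A
    outr  : ∀ {A B} → Hom (A × B) B
    ⟨_,_⟩ : ∀ {A B X} → Hom X A → Hom X B → Hom X (A × B)
    outl-⟨⟩ : ∀ {A B X} {f : Hom X A} {g : Hom X B} → outl ∘ ⟨ f , g ⟩ ≈ f
    outr-⟨⟩ : ∀ {A B X} {f : Hom X A} {g : Hom X B} → outr ∘ ⟨ f , g ⟩ ≈ g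
    ⟨⟩-unique : ∀ {A B X} {f : Hom X A} {g : Hom X B} {h : Hom X (A × B)} →
                outl ∘ h ≈ f → outr ∘ h ≈ g → h ≈ ⟨ f , g ⟩

  _⁂_ : ∀ {A B A′ B′} → Hom A A′ → Hom B B′ → Hom (A × B) (A′ × B′)
  f ⁂ g = ⟨ f ∘ outl , g ∘ outr ⟩

record Endofunctor {o ℓ e} (C : Category o ℓ e) : Set (o ⊔ ℓ ⊔ e) where
  open Category C
  field
    F₀ : Obj → Obj
    F₁ : ∀ {A B} → Hom A B → Hom (F₀ A) (F₀ B)
    identity : ∀ {A} → F₁ (id {A}) ≈ id
    homomorphism : ∀ {A B C} {f : Hom A B} {g : Hom B C} →
                   F₁ (g ∘ f) ≈ F₁ g ∘ F₁ f
    F-resp-≈ : ∀ {A B} {f g : Hom A B} → f ≈ g → F₁ f ≈ F₁ g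

record InitialAlgebra {o ℓ e} (C : Category o ℓ e) (Σ : Endofunctor C) :
       Set (o ⊔ ℓ ⊔ e) where
  open Category C
  open Endofunctor Σ
  field
    μΣ : Obj
    ι  : Hom (F₀ μΣ) μΣ
    fold : ∀ {A} → Hom (F₀ A) A → Hom μΣ A
    fold-hom : ∀ {A} (a : Hom (F₀ A) A) → fold a ∘ ι ≈ a ∘ F₁ (fold a)
    fold-unique : ∀ {A} (a : Hom (F₀ A) A) (h : Hom μΣ A) →
                  h ∘ ι ≈ a ∘ F₁ h → h ≈ fold a

record FreeAlgebras {o ℓ e} (C : Category o ℓ e) (Σ : Endofunctor C) :
       Set (o ⊔ ℓ ⊔ e) where
  open Category C
  open Endofunctor Σ
  field
    Σ⋆ : Obj → Obj
    ιF : ∀ X → Hom (F₀ (Σ⋆ X)) (Σ⋆ X)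
    η  : ∀ X → Hom X (Σ⋆ X)
    ext : ∀ {X A} → Hom (F₀ A) A → Hom X A → Hom (Σ⋆ X) A
    ext-hom : ∀ {X A} (a : Hom (F₀ A) A) (f : Hom X A) →
              ext a f ∘ ιF X ≈ a ∘ F₁ (ext a f)
    ext-η : ∀ {X A} (a : Hom (F₀ A) A) (f : Hom X A) → ext a f ∘ η X ≈ f
    ext-unique : ∀ {X A} (a : Hom (F₀ A) A) (f : Hom X A) (h : Hom (Σ⋆ X) A) →
                 h ∘ ιF X ≈ a ∘ F₁ h → h ∘ η X ≈ f → h ≈ ext a f

module Setup {o ℓ e} (C : Category o ℓ e) (P : BinaryProducts C)
             (Σ : Endofunctor C) (I : InitialAlgebra C Σ)
             (Fr : FreeAlgebras C Σ) (B : Endofunctor C) where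
  open Category C
  open BinaryProducts P
  open Endofunctor Σ renaming (F₀ to Σ₀; F₁ to Σ₁)
  open Endofunctor B renaming (F₀ to B₀; F₁ to B₁)
  open InitialAlgebra I
  open FreeAlgebras Fr

  Σ⋆₁ : ∀ {X Y} → Hom X Y → Hom (Σ⋆ X) (Σ⋆ Y)
  Σ⋆₁ {X} {Y} g = ext (ιF Y) (η Y ∘ g)

  μ : ∀ X → Hom (Σ⋆ (Σ⋆ X)) (Σ⋆ X)
  μ X = ext (ιF X) id

  ι̂ : Hom (Σ⋆ μΣ) μΣ
  ι̂ = ext ι id

  PreGSOS : Set (o ⊔ ℓ)
  PreGSOS = ∀ X → Hom (Σ₀ (X × B₀ X)) (B₀ (Σ⋆ X))

  NaturalWrt : PreGSOS → ∀ {X Y} → Hom X Y → Set e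
  NaturalWrt ρ {X} {Y} g = ρ Y ∘ Σ₁ (g ⁂ B₁ g) ≈ B₁ (Σ⋆₁ g) ∘ ρ X

  -- γ is the operational model of ρ (the unique such γ; existence and
  -- uniqueness follow from initiality, so we take γ satisfying the equation)
  IsOperationalModel : PreGSOS → Hom μΣ (B₀ μΣ) → Set e
  IsOperationalModel ρ γ = γ ∘ ι ≈ B₁ ι̂ ∘ ρ μΣ ∘ Σ₁ ⟨ id , γ ⟩

  IsExtension : PreGSOS →
                (∀ X → Hom (Σ⋆ (X × B₀ X)) (B₀ (Σ⋆ X))) → Set (o ⊔ e)
  IsExtension ρ ρ* = ∀ X →
      (ρ* X ∘ η (X × B₀ X) ≈ B₁ (η X) ∘ outr)
    Prod.× (ρ* X ∘ ιF (X × B₀ X) ≈ B₁ (μ X) ∘ ρ (Σ⋆ X) ∘ Σ₁ ⟨ Σ⋆₁ outl , ρ* X ⟩)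

{-# OPTIONS --safe #-}
-- Call h : Σ⋆μΣ → BμΣ a term model if h ∘ η = γ and h ∘ ι_μΣ = Bι̂ ∘ ρ ∘ Σ⟨ι̂, h⟩.
-- For a term model, ⟨ι̂, h⟩ is a Σ-algebra morphism from the free algebra Σ⋆μΣ
-- into (μΣ × BμΣ, ⟨ι ∘ Σ outl, Bι̂ ∘ ρ⟩) extending ⟨id, γ⟩, so by freeness there is
-- at most one term model. Both sides of the equation are term models: γ ∘ ι̂ by the
-- defining equation of γ, and Bι̂ ∘ ρ* ∘ Σ⋆⟨id, γ⟩ by the equations of ρ*, where
-- ι̂ ∘ Σ⋆ι̂ = ι̂ ∘ μ and naturality of ρ at ι̂ move ι̂ from Σ⋆(Σ⋆μΣ) down to μΣ.
module Submission where

open import Relation.Binary.Bundles using (Setoid)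
import Relation.Binary.Reasoning.Setoid as SetoidReasoning
import Data.Product as Prod
open Prod using (_,_; proj₁; proj₂)
open import Defs

module MorphismReasoning {o ℓ e} (C : Category o ℓ e) where
  open Category C

  hom-setoid : Obj → Obj → Setoid ℓ e
  hom-setoid X Y = record { Carrier = Hom X Y ; _≈_ = _≈_ ; isEquivalence = ≈-equiv }

  module ≈ {X Y : Obj} = Setoid (hom-setoid X Y)
  module HomReasoning {X Y : Obj} = SetoidReasoning (hom-setoid X Y)

  infixr 4 refl⟩∘⟨_
  infixl 5 _⟩∘⟨refl

  refl⟩∘⟨_ : ∀ {X Y Z} {f : Hom Y Z} {g g′ : Hom X Y} → g ≈ g′ → f ∘ g ≈ f ∘ g′
  refl⟩∘⟨ p = ∘-resp-≈ ≈.refl p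

  _⟩∘⟨refl : ∀ {X Y Z} {f f′ : Hom Y Z} {g : Hom X Y} → f ≈ f′ → f ∘ g ≈ f′ ∘ g
  p ⟩∘⟨refl = ∘-resp-≈ p ≈.refl

  module _ {W X Y Z : Obj} {f : Hom W X} where

    pullʳ : ∀ {g : Hom X Y} {h : Hom Y Z} {k : Hom W Y} →
            g ∘ f ≈ k → (h ∘ g) ∘ f ≈ h ∘ k
    pullʳ p = ≈.trans assoc (refl⟩∘⟨ p)

    pullˡ : ∀ {g : Hom X Y} {h : Hom Y Z} {k : Hom X Z} →
            h ∘ g ≈ k → h ∘ (g ∘ f) ≈ k ∘ f
    pullˡ p = ≈.trans (≈.sym assoc) (p ⟩∘⟨refl)

  cancelˡ : ∀ {W X Y} {f : Hom W X} {g : Hom X Y} {h : Hom Y X} →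
            h ∘ g ≈ id → h ∘ (g ∘ f) ≈ f
  cancelˡ p = ≈.trans (pullˡ p) identityˡ

  extendʳ : ∀ {W X Y Y′ Z} {f : Hom W X} {g : Hom X Y} {h : Hom Y Z}
              {g′ : Hom X Y′} {h′ : Hom Y′ Z} →
            h ∘ g ≈ h′ ∘ g′ → h ∘ (g ∘ f) ≈ h′ ∘ (g′ ∘ f)
  extendʳ p = ≈.trans (pullˡ p) assoc

  elimʳ : ∀ {X Y} {f : Hom X X} {g : Hom X Y} → f ≈ id → g ∘ f ≈ g
  elimʳ p = ≈.trans (refl⟩∘⟨ p) identityʳ

module FunctorLaws {o ℓ e} {C : Category o ℓ e} (F : Endofunctor C) where
  open Category C
  open Endofunctor F
  open MorphismReasoning C

  resp-∘ : ∀ {X Y Z} {f : Hom X Y} {g : Hom Y Z} {h : Hom X Z} →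
           g ∘ f ≈ h → F₁ g ∘ F₁ f ≈ F₁ h
  resp-∘ p = ≈.trans (≈.sym homomorphism) (F-resp-≈ p)

module ProductLaws {o ℓ e} {C : Category o ℓ e} (P : BinaryProducts C) where
  open Category C
  open BinaryProducts P
  open MorphismReasoning C

  ⟨⟩-cong₂ : ∀ {X A B} {f f′ : Hom X A} {g g′ : Hom X B} →
             f ≈ f′ → g ≈ g′ → ⟨ f , g ⟩ ≈ ⟨ f′ , g′ ⟩
  ⟨⟩-cong₂ p q = ⟨⟩-unique (≈.trans outl-⟨⟩ p) (≈.trans outr-⟨⟩ q)

  ⟨⟩∘ : ∀ {W X A B} {f : Hom X A} {g : Hom X B} {h : Hom W X} →
        ⟨ f , g ⟩ ∘ h ≈ ⟨ f ∘ h , g ∘ h ⟩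
  ⟨⟩∘ = ⟨⟩-unique (pullˡ outl-⟨⟩) (pullˡ outr-⟨⟩)

  ⁂∘⟨⟩ : ∀ {X A B A′ B′} {f : Hom A A′} {g : Hom B B′} {h : Hom X A} {k : Hom X B} →
         (f ⁂ g) ∘ ⟨ h , k ⟩ ≈ ⟨ f ∘ h , g ∘ k ⟩
  ⁂∘⟨⟩ = ≈.trans ⟨⟩∘ (⟨⟩-cong₂ (pullʳ outl-⟨⟩) (pullʳ outr-⟨⟩))

  ⟨⟩-injectiveʳ : ∀ {X A B} {f f′ : Hom X A} {g g′ : Hom X B} →
                  ⟨ f , g ⟩ ≈ ⟨ f′ , g′ ⟩ → g ≈ g′
  ⟨⟩-injectiveʳ {f = f} {f′} {g} {g′} p = begin
    g                  ≈⟨ outr-⟨⟩ ⟨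
    outr ∘ ⟨ f , g ⟩   ≈⟨ refl⟩∘⟨ p ⟩
    outr ∘ ⟨ f′ , g′ ⟩ ≈⟨ outr-⟨⟩ ⟩
    g′                 ∎
    where open HomReasoning

module FreeAlgebraLaws {o ℓ e} {C : Category o ℓ e} {Σ : Endofunctor C}
                       (Fr : FreeAlgebras C Σ) where
  open Category C
  open Endofunctor Σ using () renaming (F₀ to Σ₀; F₁ to Σ₁; identity to Σ-identity)
  open FreeAlgebras Fr
  open MorphismReasoning C
  open FunctorLaws Σ renaming (resp-∘ to Σ-resp-∘)

  ext-cong : ∀ {X A} {a : Hom (Σ₀ A) A} {f g : Hom X A} → f ≈ g → ext a f ≈ ext a g
  ext-cong {a = a} {f} {g} p = ext-unique a g (ext a f) (ext-hom a f) (≈.trans (ext-η a f) p)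

  ext-fusion : ∀ {X A D} {a : Hom (Σ₀ A) A} {d : Hom (Σ₀ D) D} {q : Hom A D} {f : Hom X A} →
               q ∘ a ≈ d ∘ Σ₁ q → q ∘ ext a f ≈ ext d (q ∘ f)
  ext-fusion {X} {a = a} {d} {q} {f} q-hom =
    ext-unique d (q ∘ f) (q ∘ ext a f) commutes (pullʳ (ext-η a f))
    where
      open HomReasoning
      commutes : (q ∘ ext a f) ∘ ιF X ≈ d ∘ Σ₁ (q ∘ ext a f)
      commutes = begin
        (q ∘ ext a f) ∘ ιF X      ≈⟨ pullʳ (ext-hom a f) ⟩
        q ∘ a ∘ Σ₁ (ext a f)      ≈⟨ pullˡ q-hom ⟩
        (d ∘ Σ₁ q) ∘ Σ₁ (ext a f) ≈⟨ pullʳ (Σ-resp-∘ ≈.refl) ⟩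
        d ∘ Σ₁ (q ∘ ext a f)      ∎

  ext-η≈id : ∀ {X} → ext (ιF X) (η X) ≈ id
  ext-η≈id {X} = ≈.sym (ext-unique (ιF X) (η X) id
    (≈.trans identityˡ (≈.sym (elimʳ Σ-identity)))
    identityˡ)

module FreeMonadLaws {o ℓ e} (C : Category o ℓ e) (P : BinaryProducts C)
                     (Σ : Endofunctor C) (I : InitialAlgebra C Σ)
                     (Fr : FreeAlgebras C Σ) (B : Endofunctor C) where
  open Category C
  open Endofunctor Σ using () renaming (F₀ to Σ₀)
  open FreeAlgebras Fr
  open Setup C P Σ I Fr B
  open MorphismReasoning C
  open FreeAlgebraLaws Fr

  Σ⋆-identity : ∀ {X} → Σ⋆₁ (id {X}) ≈ id
  Σ⋆-identity = ≈.trans (ext-cong identityʳ) ext-η≈id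

  Σ⋆-resp-∘ : ∀ {X Y Z} {f : Hom X Y} {g : Hom Y Z} {h : Hom X Z} →
              g ∘ f ≈ h → Σ⋆₁ g ∘ Σ⋆₁ f ≈ Σ⋆₁ h
  Σ⋆-resp-∘ p = ≈.trans (ext-fusion (ext-hom _ _))
    (ext-cong (≈.trans (pullˡ (ext-η _ _)) (≈.trans assoc (refl⟩∘⟨ p))))

  ext-id-μ : ∀ {A} (a : Hom (Σ₀ A) A) → ext a id ∘ Σ⋆₁ (ext a id) ≈ ext a id ∘ μ A
  ext-id-μ a = begin
    ext a id ∘ Σ⋆₁ (ext a id)         ≈⟨ ext-fusion (ext-hom a id) ⟩
    ext a (ext a id ∘ η _ ∘ ext a id) ≈⟨ ext-cong (≈.trans (pullˡ (ext-η a id)) identityˡ) ⟩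
    ext a (ext a id)                  ≈⟨ ext-cong identityʳ ⟨
    ext a (ext a id ∘ id)             ≈⟨ ext-fusion (ext-hom a id) ⟨
    ext a id ∘ μ _                    ∎
    where open HomReasoning

module TermModels {o ℓ e} (C : Category o ℓ e) (P : BinaryProducts C)
                  (Σ : Endofunctor C) (I : InitialAlgebra C Σ)
                  (Fr : FreeAlgebras C Σ) (B : Endofunctor C)
                  (ρ : Setup.PreGSOS C P Σ I Fr B)
                  (γ : Category.Hom C (InitialAlgebra.μΣ I)
                         (Endofunctor.F₀ B (InitialAlgebra.μΣ I))) where
  open Category C
  open BinaryProducts P
  open Endofunctor Σ using () renaming (F₀ to Σ₀; F₁ to Σ₁)
  open Endofunctor B using () renaming (F₀ to B₀; F₁ to B₁; identity to B-identity)
  open InitialAlgebra I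
  open FreeAlgebras Fr
  open Setup C P Σ I Fr B
  open MorphismReasoning C
  open FunctorLaws Σ renaming (resp-∘ to Σ-resp-∘)
  open FunctorLaws B renaming (resp-∘ to B-resp-∘)
  open ProductLaws P
  open FreeMonadLaws C P Σ I Fr B
  open HomReasoning

  IsTermModel : Hom (Σ⋆ μΣ) (B₀ μΣ) → Set e
  IsTermModel h = h ∘ η μΣ ≈ γ Prod.× h ∘ ιF μΣ ≈ B₁ ι̂ ∘ ρ μΣ ∘ Σ₁ ⟨ ι̂ , h ⟩

  ρ-algebra : Hom (Σ₀ (μΣ × B₀ μΣ)) (μΣ × B₀ μΣ)
  ρ-algebra = ⟨ ι ∘ Σ₁ outl , B₁ ι̂ ∘ ρ μΣ ⟩

  term-model-pairing : ∀ {h} → IsTermModel h → ⟨ ι̂ , h ⟩ ≈ ext ρ-algebra ⟨ id , γ ⟩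
  term-model-pairing {h} (h-η , h-ι) =
    ext-unique ρ-algebra ⟨ id , γ ⟩ ⟨ ι̂ , h ⟩ commutes
      (≈.trans ⟨⟩∘ (⟨⟩-cong₂ (ext-η ι id) h-η))
    where
      commutes : ⟨ ι̂ , h ⟩ ∘ ιF μΣ ≈ ρ-algebra ∘ Σ₁ ⟨ ι̂ , h ⟩
      commutes = begin
        ⟨ ι̂ , h ⟩ ∘ ιF μΣ                                ≈⟨ ⟨⟩∘ ⟩
        ⟨ ι̂ ∘ ιF μΣ , h ∘ ιF μΣ ⟩                        ≈⟨ ⟨⟩-cong₂ (ext-hom ι id) h-ι ⟩
        ⟨ ι ∘ Σ₁ ι̂ , B₁ ι̂ ∘ ρ μΣ ∘ Σ₁ ⟨ ι̂ , h ⟩ ⟩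
          ≈⟨ ⟨⟩-cong₂ (pullʳ (Σ-resp-∘ outl-⟨⟩)) assoc ⟨
        ⟨ (ι ∘ Σ₁ outl) ∘ Σ₁ ⟨ ι̂ , h ⟩ , (B₁ ι̂ ∘ ρ μΣ) ∘ Σ₁ ⟨ ι̂ , h ⟩ ⟩ ≈⟨ ⟨⟩∘ ⟨
        ρ-algebra ∘ Σ₁ ⟨ ι̂ , h ⟩                         ∎

  term-model-unique : ∀ {h h′} → IsTermModel h → IsTermModel h′ → h ≈ h′
  term-model-unique h-model h′-model =
    ⟨⟩-injectiveʳ (≈.trans (term-model-pairing h-model) (≈.sym (term-model-pairing h′-model)))

  operational-model-term-model : IsOperationalModel ρ γ → IsTermModel (γ ∘ ι̂)
  operational-model-term-model γ-ι = ≈.trans (pullʳ (ext-η ι id)) identityʳ , commutes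
    where
      commutes : (γ ∘ ι̂) ∘ ιF μΣ ≈ B₁ ι̂ ∘ ρ μΣ ∘ Σ₁ ⟨ ι̂ , γ ∘ ι̂ ⟩
      commutes = begin
        (γ ∘ ι̂) ∘ ιF μΣ                           ≈⟨ pullʳ (ext-hom ι id) ⟩
        γ ∘ ι ∘ Σ₁ ι̂                              ≈⟨ pullˡ γ-ι ⟩
        (B₁ ι̂ ∘ ρ μΣ ∘ Σ₁ ⟨ id , γ ⟩) ∘ Σ₁ ι̂       ≈⟨ pullʳ (pullʳ (Σ-resp-∘ ⟨id,γ⟩∘ι̂)) ⟩
        B₁ ι̂ ∘ ρ μΣ ∘ Σ₁ ⟨ ι̂ , γ ∘ ι̂ ⟩             ∎
        where
          ⟨id,γ⟩∘ι̂ : ⟨ id , γ ⟩ ∘ ι̂ ≈ ⟨ ι̂ , γ ∘ ι̂ ⟩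
          ⟨id,γ⟩∘ι̂ = ≈.trans ⟨⟩∘ (⟨⟩-cong₂ identityˡ ≈.refl)

  module _ (ρ* : ∀ X → Hom (Σ⋆ (X × B₀ X)) (B₀ (Σ⋆ X))) where

    extension-term-model : IsExtension ρ ρ* → NaturalWrt ρ ι̂ →
                           IsTermModel (B₁ ι̂ ∘ ρ* μΣ ∘ Σ⋆₁ ⟨ id , γ ⟩)
    extension-term-model ρ*-eqs ρ-natural = on-variables , on-operations
      where
        k : Hom (Σ⋆ μΣ) (Σ⋆ (μΣ × B₀ μΣ))
        k = Σ⋆₁ ⟨ id , γ ⟩

        π : Hom (Σ⋆ (μΣ × B₀ μΣ)) (Σ⋆ μΣ × B₀ (Σ⋆ μΣ))
        π = ⟨ Σ⋆₁ outl , ρ* μΣ ⟩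

        on-variables : (B₁ ι̂ ∘ ρ* μΣ ∘ k) ∘ η μΣ ≈ γ
        on-variables = begin
          (B₁ ι̂ ∘ ρ* μΣ ∘ k) ∘ η μΣ             ≈⟨ pullʳ (pullʳ (ext-η _ _)) ⟩
          B₁ ι̂ ∘ ρ* μΣ ∘ η _ ∘ ⟨ id , γ ⟩        ≈⟨ refl⟩∘⟨ pullˡ (proj₁ (ρ*-eqs μΣ)) ⟩
          B₁ ι̂ ∘ (B₁ (η μΣ) ∘ outr) ∘ ⟨ id , γ ⟩ ≈⟨ refl⟩∘⟨ pullʳ outr-⟨⟩ ⟩
          B₁ ι̂ ∘ B₁ (η μΣ) ∘ γ                   ≈⟨ cancelˡ (≈.trans (B-resp-∘ (ext-η ι id)) B-identity) ⟩
          γ                                      ∎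

        Σ⋆outl∘k≈id : Σ⋆₁ outl ∘ k ≈ id
        Σ⋆outl∘k≈id = ≈.trans (Σ⋆-resp-∘ outl-⟨⟩) Σ⋆-identity

        ⁂∘π∘k : (ι̂ ⁂ B₁ ι̂) ∘ π ∘ k ≈ ⟨ ι̂ , B₁ ι̂ ∘ ρ* μΣ ∘ k ⟩
        ⁂∘π∘k = begin
          (ι̂ ⁂ B₁ ι̂) ∘ π ∘ k                       ≈⟨ refl⟩∘⟨ ⟨⟩∘ ⟩
          (ι̂ ⁂ B₁ ι̂) ∘ ⟨ Σ⋆₁ outl ∘ k , ρ* μΣ ∘ k ⟩ ≈⟨ ⁂∘⟨⟩ ⟩
          ⟨ ι̂ ∘ Σ⋆₁ outl ∘ k , B₁ ι̂ ∘ ρ* μΣ ∘ k ⟩   ≈⟨ ⟨⟩-cong₂ (elimʳ Σ⋆outl∘k≈id) ≈.refl ⟩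
          ⟨ ι̂ , B₁ ι̂ ∘ ρ* μΣ ∘ k ⟩                   ∎

        B-ι̂∘μ : B₁ ι̂ ∘ B₁ (Σ⋆₁ ι̂) ≈ B₁ ι̂ ∘ B₁ (μ μΣ)
        B-ι̂∘μ = ≈.trans (B-resp-∘ (ext-id-μ ι)) (≈.sym (B-resp-∘ ≈.refl))

        on-operations : (B₁ ι̂ ∘ ρ* μΣ ∘ k) ∘ ιF μΣ ≈
                        B₁ ι̂ ∘ ρ μΣ ∘ Σ₁ ⟨ ι̂ , B₁ ι̂ ∘ ρ* μΣ ∘ k ⟩
        on-operations = begin
          (B₁ ι̂ ∘ ρ* μΣ ∘ k) ∘ ιF μΣ                   ≈⟨ pullʳ (pullʳ (ext-hom _ _)) ⟩
          B₁ ι̂ ∘ ρ* μΣ ∘ ιF _ ∘ Σ₁ k                   ≈⟨ refl⟩∘⟨ pullˡ (proj₂ (ρ*-eqs μΣ)) ⟩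
          B₁ ι̂ ∘ (B₁ (μ μΣ) ∘ ρ (Σ⋆ μΣ) ∘ Σ₁ π) ∘ Σ₁ k ≈⟨ refl⟩∘⟨ pullʳ (pullʳ (Σ-resp-∘ ≈.refl)) ⟩
          B₁ ι̂ ∘ B₁ (μ μΣ) ∘ ρ (Σ⋆ μΣ) ∘ Σ₁ (π ∘ k)    ≈⟨ extendʳ B-ι̂∘μ ⟨
          B₁ ι̂ ∘ B₁ (Σ⋆₁ ι̂) ∘ ρ (Σ⋆ μΣ) ∘ Σ₁ (π ∘ k)   ≈⟨ refl⟩∘⟨ extendʳ ρ-natural ⟨
          B₁ ι̂ ∘ ρ μΣ ∘ Σ₁ (ι̂ ⁂ B₁ ι̂) ∘ Σ₁ (π ∘ k)     ≈⟨ refl⟩∘⟨ refl⟩∘⟨ Σ-resp-∘ ⁂∘π∘k ⟩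
          B₁ ι̂ ∘ ρ μΣ ∘ Σ₁ ⟨ ι̂ , B₁ ι̂ ∘ ρ* μΣ ∘ k ⟩    ∎

lemma47 : ∀ {o ℓ e} (C : Category o ℓ e) (P : BinaryProducts C)
            (Σ : Endofunctor C) (I : InitialAlgebra C Σ)
            (Fr : FreeAlgebras C Σ) (B : Endofunctor C)
            (ρ : Setup.PreGSOS C P Σ I Fr B)
            (γ : Category.Hom C (InitialAlgebra.μΣ I)
                   (Endofunctor.F₀ B (InitialAlgebra.μΣ I)))
            (ρ* : ∀ X → Category.Hom C
                   (FreeAlgebras.Σ⋆ Fr (BinaryProducts._×_ P X (Endofunctor.F₀ B X)))
                   (Endofunctor.F₀ B (FreeAlgebras.Σ⋆ Fr X))) →
          Setup.IsOperationalModel C P Σ I Fr B ρ γ →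
          Setup.IsExtension C P Σ I Fr B ρ ρ* →
          Setup.NaturalWrt C P Σ I Fr B ρ (Setup.ι̂ C P Σ I Fr B) →
          let open Category C
              open BinaryProducts P
              open Setup C P Σ I Fr B
              open Endofunctor B renaming (F₁ to B₁)
          in γ ∘ ι̂ ≈ B₁ ι̂ ∘ ρ* (InitialAlgebra.μΣ I) ∘ Σ⋆₁ ⟨ id , γ ⟩
lemma47 C P Σ I Fr B ρ γ ρ* γ-model ρ*-extension ρ-natural =
  term-model-unique (operational-model-term-model γ-model)
                    (extension-term-model ρ* ρ*-extension ρ-natural)
  where open TermModels C P Σ I Fr B ρ γ
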